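{- The functors $G^\varepsilon$ and $G^\delta$ from the category $S$ to the category $\mathit{Rel}$ are faithful.
   Context: The category $S$ is defined syntactically. Its objects are the finite ordinals (natural numbers) $n$. Its primitive arrow terms are $\mathbf{1}_n : n \vdash n$ and $\xi_n : n+1 \vdash n$ for every $n \ge 0$. Arrow terms are generated from the primitive ones by two operations: - if $f : n \vdash m$ and $g : m \vdash k$ are arrow terms, then $g \circ f : n \vdash k$ is an arrow term; - if $f : n \vdash m$ is an arrow term, then $Mf : n+1 \vdash m+1$ is an arrow term. The arrows of $S$ are the equivalence classes of arrow terms under the smallest equivalence relation that relates only terms of the same type, is a congruence for $\circ$ and $M$, and contains all instances of the following equations (for $f:n\vdash m$ and all composable $f,g,h$): - $f \circ \mathbf{1}_n = \mathbf{1}_m \circ f = f$; - $h \circ (g \circ f) = (h \circ g) \circ f$; - $M\mathbf{1}_n = \mathbf{1}_{n+1}$; - $M(g \circ f) = Mg \circ Mf$; - $\xi_m \circ Mf = f \circ \xi_n$. $\mathit{Rel}$ is the category whose objects are the finite ordinals, whose arrows $n \to m$ are relations $R \subseteq n \times m$, with composition of relations and identity relations. For $\alpha \in \{\varepsilon, \delta\}$ the functor $G^\alpha : S \to \mathit{Rel}$ is defined as follows. On objects, $G^\alpha n = n$. On arrows: - $G^\alpha \mathbf{1}_n$ is the identity relation on $n$; - $G^\alpha \xi_0$ is the empty relation between $1$ and $0$; - for $n \ge 1$, $G^\varepsilon \xi_n = \{(i,i) : i < n\} \subseteq (n+1) \times n$; - for $n \ge 1$, $G^\delta \xi_n = \{(i,i)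 : i < n\} \cup \{(n, n-1)\}$; - $G^\alpha(g \circ f) = G^\alpha g \circ G^\alpha f$; - for $f : n \vdash m$, $G^\alpha Mf = G^\alpha f \cup \{(n,m)\}$. These clauses give well-defined functors. -}

module Defs where

open import Data.Nat using (ℕ; zero; suc; _≡ᵇ_)
open import Data.Fin using (Fin; zero; suc; toℕ)
open import Data.Bool using (Bool; true; false; _∧_; _∨_)
open import Data.Maybe using (Maybe; just; nothing)
import Data.Maybe as Maybe
open import Relation.Binary.PropositionalEquality using (_≡_)

data Term : ℕ → ℕ → Set where
  𝟏   : (n : ℕ) → Term n n
  ξ   : (n : ℕ) → Term (suc n) n
  _∘_ : ∀ {n m k} → Term m k → Term n m → Term n k
  M   : ∀ {n m} → Term n m → Term (suc n) (suc m)

infixr 9 _∘_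
infix 4 _≈_

data _≈_ : ∀ {n m} → Term n m → Term n m → Set where
  ≈-refl  : ∀ {n m} {f : Term n m} → f ≈ f
  ≈-sym   : ∀ {n m} {f g : Term n m} → f ≈ g → g ≈ f
  ≈-trans : ∀ {n m} {f g h : Term n m} → f ≈ g → g ≈ h → f ≈ h
  ∘-cong  : ∀ {n m k} {g g′ : Term m k} {f f′ : Term n m} →
            g ≈ g′ → f ≈ f′ → g ∘ f ≈ g′ ∘ f′
  M-cong  : ∀ {n m} {f f′ : Term n m} → f ≈ f′ → M f ≈ M f′
  idʳ     : ∀ {n m} (f : Term n m) → f ∘ 𝟏 n ≈ f
  idˡ     : ∀ {n m} (f : Term n m) → 𝟏 m ∘ f ≈ f
  assoc   : ∀ {n m k l} (h : Term k l) (g : Term m k) (f : Term n m) →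
            h ∘ (g ∘ f) ≈ (h ∘ g) ∘ f
  M𝟏      : (n : ℕ) → M (𝟏 n) ≈ 𝟏 (suc n)
  M∘      : ∀ {n m k} (g : Term m k) (f : Term n m) → M (g ∘ f) ≈ M g ∘ M f
  ξ-nat   : ∀ {n m} (f : Term n m) → ξ m ∘ M f ≈ f ∘ ξ n

Relation : ℕ → ℕ → Set
Relation n m = Fin n → Fin m → Bool

_≐_ : ∀ {n m} → Relation n m → Relation n m → Set
R ≐ R′ = ∀ i j → R i j ≡ R′ i j

anyFin : ∀ {m} → (Fin m → Bool) → Bool
anyFin {zero}  p = false
anyFin {suc m} p = p zero ∨ anyFin (λ j → p (suc j))

idRel : (n : ℕ) → Relation n n
idRel n i j = toℕ i ≡ᵇ toℕ j

-- relational composition  S ∘ R  (first R, then S)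
_⊚_ : ∀ {n m k} → Relation m k → Relation n m → Relation n k
(S ⊚ R) i k = anyFin (λ j → R i j ∧ S j k)

emptyRel : ∀ {n m} → Relation n m
emptyRel _ _ = false

-- For i : Fin (suc n): nothing if i = n (the last element), just i otherwise.
initial? : (n : ℕ) → Fin (suc n) → Maybe (Fin n)
initial? zero    zero    = nothing
initial? (suc n) zero    = just zero
initial? (suc n) (suc i) = Maybe.map suc (initial? n i)

-- R ∪ {(n , m)} as a relation on (n+1) × (m+1)
extend : ∀ {n m} → Relation n m → Relation (suc n) (suc m)
extend {n} {m} R i j with initial? n i | initial? m j
... | just i′  | just j′  = R i′ j′
... | nothing  | nothing  = true
... | just _   | nothing  = false
... | nothing  | just _   = false

data Variant : Set where
  ε δ : Variant

Gξ : Variant → (n : ℕ) → Relation (suc n) n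
Gξ α zero    = λ _ ()
Gξ ε (suc n) i j = toℕ i ≡ᵇ toℕ j
Gξ δ (suc n) i j = (toℕ i ≡ᵇ toℕ j) ∨ ((toℕ i ≡ᵇ suc n) ∧ (toℕ j ≡ᵇ n))

G : Variant → ∀ {n m} → Term n m → Relation n m
G α (𝟏 n)   = idRel n
G α (ξ n)   = Gξ α n
G α (g ∘ f) = G α g ⊚ G α f
G α (M f)   = extend (G α f)

Faithful : Variant → Set
Faithful α = ∀ {n m} (f g : Term n m) → G α f ≐ G α g → f ≈ g

-- Each relation G α f is the graph of a partial map P α f from Fin n to Fin m: ξ^ε
-- forgets the last point, ξ^δ sends it to the new last point, and M f extends f by
-- sending last to last; f ↦ P α f respects the equations of S.  Conversely, pushing ξ
-- to the right with ξ ∘ M f = f ∘ ξ, every arrow term is equal in S to a normal form, a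
-- word in M and precomposition with ξ, and the partial map of a normal form determines
-- its first letter: M keeps the last point while ξ^ε drops it; for δ, M keeps the
-- second-to-last point off the last one, while ξ^δ followed by a (necessarily
-- last-preserving) map sends it to the last one.  So G α f = G α g forces nf f = nf g,
-- hence f = g in S.
module Submission where

open import Defs
open import Data.Bool using (Bool; true; false; _∧_; _∨_; T)
open import Data.Bool.Properties using (∨-identityʳ)
open import Data.Fin using (Fin; zero; suc; toℕ; inject₁; fromℕ)
open import Data.Fin.Properties
  using (toℕ-injective; toℕ-inject₁; toℕ-fromℕ; toℕ<n; fromℕ≢inject₁; inject₁-injective)
open import Data.Maybe using (Maybe; just; nothing; _>>=_; _<∣>_; maybe′)
import Data.Maybe as Maybe
open import Data.Maybe.Properties using (just-injective; map-injective)
open import Data.Nat using (ℕ; zero; suc; _≡ᵇ_)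
open import Data.Nat.Properties using (≡ᵇ⇒≡; <⇒≢; >⇒≢)
open import Data.Product using (_×_; _,_)
open import Data.Unit using (⊤; tt)
open import Relation.Binary.PropositionalEquality
  using (_≡_; _≢_; refl; sym; trans; cong; cong₂; subst; module ≡-Reasoning)
open import Relation.Nullary using (¬_; contradiction)

≡ᵇ-refl : ∀ n → (n ≡ᵇ n) ≡ true
≡ᵇ-refl zero    = refl
≡ᵇ-refl (suc n) = ≡ᵇ-refl n

≡ᵇ-sym : ∀ m n → (m ≡ᵇ n) ≡ (n ≡ᵇ m)
≡ᵇ-sym zero    zero    = refl
≡ᵇ-sym zero    (suc n) = refl
≡ᵇ-sym (suc m) zero    = refl
≡ᵇ-sym (suc m) (suc n) = ≡ᵇ-sym m n

≡ᵇ-true⇒≡ : ∀ m n → (m ≡ᵇ n) ≡ true → m ≡ n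
≡ᵇ-true⇒≡ m n eq = ≡ᵇ⇒≡ m n (subst T (sym eq) tt)

≢⇒≡ᵇ-false : ∀ {m n} → m ≢ n → (m ≡ᵇ n) ≡ false
≢⇒≡ᵇ-false {m} {n} m≢n with m ≡ᵇ n in eq
... | false = refl
... | true  = contradiction (≡ᵇ-true⇒≡ m n eq) m≢n

toℕ-≡ᵇ-≢ : ∀ {n} {i j : Fin n} → i ≢ j → (toℕ i ≡ᵇ toℕ j) ≡ false
toℕ-≡ᵇ-≢ i≢j = ≢⇒≡ᵇ-false (λ eq → i≢j (toℕ-injective eq))

data Inject₁OrLast (n : ℕ) : Fin (suc n) → Set where
  inject : (i : Fin n) → Inject₁OrLast n (inject₁ i)
  last   : Inject₁OrLast n (fromℕ n)

inject₁-or-last : ∀ n (i : Fin (suc n)) → Inject₁OrLast n i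
inject₁-or-last zero    zero    = last
inject₁-or-last (suc n) zero    = inject zero
inject₁-or-last (suc n) (suc i) with inject₁-or-last n i
... | inject j = inject (suc j)
... | last     = last

initial?-inject₁ : ∀ n (i : Fin n) → initial? n (inject₁ i) ≡ just i
initial?-inject₁ (suc n) zero    = refl
initial?-inject₁ (suc n) (suc i) rewrite initial?-inject₁ n i = refl

initial?-fromℕ : ∀ n → initial? n (fromℕ n) ≡ nothing
initial?-fromℕ zero    = refl
initial?-fromℕ (suc n) rewrite initial?-fromℕ n = refl

lastOf : (n : ℕ) → Maybe (Fin n)
lastOf zero    = nothing
lastOf (suc n) = just (fromℕ n)

PF : ℕ → ℕ → Set
PF n m = Fin n → Maybe (Fin m)

_≗ᴾ_ : ∀ {n m} → PF n m → PF n m → Set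
p ≗ᴾ q = ∀ i → p i ≡ q i

>>=-identityʳ : ∀ {n} (x : Maybe (Fin n)) → (x >>= just) ≡ x
>>=-identityʳ nothing  = refl
>>=-identityʳ (just x) = refl

>>=-assoc : ∀ {a b c} (x : Maybe (Fin a)) (p : PF a b) (q : PF b c) →
            ((x >>= p) >>= q) ≡ (x >>= λ y → p y >>= q)
>>=-assoc nothing  p q = refl
>>=-assoc (just x) p q = refl

>>=-congʳ : ∀ {a b} (x : Maybe (Fin a)) {p q : PF a b} → p ≗ᴾ q → (x >>= p) ≡ (x >>= q)
>>=-congʳ nothing  p≗q = refl
>>=-congʳ (just x) p≗q = p≗q x

extendᴾ : ∀ {n m} → PF n m → PF (suc n) (suc m)
extendᴾ {n} {m} p i = maybe′ (λ i′ → Maybe.map inject₁ (p i′)) (just (fromℕ m)) (initial? n i)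

extendᴾ-inject₁ : ∀ {n m} (p : PF n m) i → extendᴾ p (inject₁ i) ≡ Maybe.map inject₁ (p i)
extendᴾ-inject₁ {n} p i rewrite initial?-inject₁ n i = refl

extendᴾ-fromℕ : ∀ {n m} (p : PF n m) → extendᴾ p (fromℕ n) ≡ just (fromℕ m)
extendᴾ-fromℕ {n} p rewrite initial?-fromℕ n = refl

ξᴾ : Variant → (n : ℕ) → PF (suc n) n
ξᴾ ε n i = initial? n i
ξᴾ δ n i = initial? n i <∣> lastOf n

ξᴾ-inject₁ : ∀ α n (i : Fin n) → ξᴾ α n (inject₁ i) ≡ just i
ξᴾ-inject₁ ε n i = initial?-inject₁ n i
ξᴾ-inject₁ δ n i rewrite initial?-inject₁ n i = refl

ξᴾ-fromℕ-ε : ∀ n → ξᴾ ε n (fromℕ n) ≡ nothing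
ξᴾ-fromℕ-ε n = initial?-fromℕ n

ξᴾ-fromℕ-δ : ∀ n → ξᴾ δ n (fromℕ n) ≡ lastOf n
ξᴾ-fromℕ-δ n rewrite initial?-fromℕ n = refl

P : Variant → ∀ {n m} → Term n m → PF n m
P α (𝟏 n)   = just
P α (ξ n)   = ξᴾ α n
P α (g ∘ f) = λ i → P α f i >>= P α g
P α (M f)   = extendᴾ (P α f)

extendᴾ-cong : ∀ {n m} {p q : PF n m} → p ≗ᴾ q → extendᴾ p ≗ᴾ extendᴾ q
extendᴾ-cong {n} {m} {p} {q} p≗q i with inject₁-or-last n i
... | inject i = begin
  extendᴾ p (inject₁ i)     ≡⟨ extendᴾ-inject₁ p i ⟩
  Maybe.map inject₁ (p i)   ≡⟨ cong (Maybe.map inject₁) (p≗q i) ⟩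
  Maybe.map inject₁ (q i)   ≡⟨ extendᴾ-inject₁ q i ⟨
  extendᴾ q (inject₁ i)     ∎
  where open ≡-Reasoning
... | last = trans (extendᴾ-fromℕ p) (sym (extendᴾ-fromℕ q))

extendᴾ-just : ∀ {n} → extendᴾ {n} just ≗ᴾ just
extendᴾ-just {n} i with inject₁-or-last n i
... | inject i = extendᴾ-inject₁ just i
... | last     = extendᴾ-fromℕ just

extendᴾ->>= : ∀ {n m k} (p : PF n m) (q : PF m k) →
              extendᴾ (λ x → p x >>= q) ≗ᴾ (λ x → extendᴾ p x >>= extendᴾ q)
extendᴾ->>= {n} p q i with inject₁-or-last n i
... | inject i = begin
  extendᴾ (λ x → p x >>= q) (inject₁ i)          ≡⟨ extendᴾ-inject₁ (λ x → p x >>= q) i ⟩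
  Maybe.map inject₁ (p i >>= q)                   ≡⟨ map-inject₁->>= (p i) ⟩
  (Maybe.map inject₁ (p i) >>= extendᴾ q)         ≡⟨ cong (_>>= extendᴾ q) (extendᴾ-inject₁ p i) ⟨
  (extendᴾ p (inject₁ i) >>= extendᴾ q)           ∎
  where
  open ≡-Reasoning
  map-inject₁->>= : ∀ z → Maybe.map inject₁ (z >>= q) ≡ (Maybe.map inject₁ z >>= extendᴾ q)
  map-inject₁->>= nothing  = refl
  map-inject₁->>= (just a) = sym (extendᴾ-inject₁ q a)
... | last = begin
  extendᴾ (λ x → p x >>= q) (fromℕ n)   ≡⟨ extendᴾ-fromℕ (λ x → p x >>= q) ⟩
  just (fromℕ _)                        ≡⟨ extendᴾ-fromℕ q ⟨
  extendᴾ q (fromℕ _)                   ≡⟨⟩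
  (just (fromℕ _) >>= extendᴾ q)        ≡⟨ cong (_>>= extendᴾ q) (extendᴾ-fromℕ p) ⟨
  (extendᴾ p (fromℕ n) >>= extendᴾ q)   ∎
  where open ≡-Reasoning

PreservesLast : ∀ {n m} → PF n m → Set
PreservesLast {n} {m} p = (lastOf n >>= p) ≡ lastOf m

-- ξ^ε commutes with the extension of every partial map, ξ^δ only with last-preserving ones.
ξ-Compatible : Variant → ∀ {n m} → PF n m → Set
ξ-Compatible ε p = ⊤
ξ-Compatible δ p = PreservesLast p

ξᴾ-natural : ∀ α {n m} (p : PF n m) → ξ-Compatible α p →
             (λ i → extendᴾ p i >>= ξᴾ α m) ≗ᴾ (λ i → ξᴾ α n i >>= p)
ξᴾ-natural α {n} {m} p compat i with inject₁-or-last n i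
... | inject i = begin
  (extendᴾ p (inject₁ i) >>= ξᴾ α m)     ≡⟨ cong (_>>= ξᴾ α m) (extendᴾ-inject₁ p i) ⟩
  (Maybe.map inject₁ (p i) >>= ξᴾ α m)   ≡⟨ ξ-after-inject₁ (p i) ⟩
  p i                                    ≡⟨ cong (_>>= p) (ξᴾ-inject₁ α n i) ⟨
  (ξᴾ α n (inject₁ i) >>= p)             ∎
  where
  open ≡-Reasoning
  ξ-after-inject₁ : ∀ z → (Maybe.map inject₁ z >>= ξᴾ α m) ≡ z
  ξ-after-inject₁ nothing  = refl
  ξ-after-inject₁ (just a) = ξᴾ-inject₁ α m a
ξᴾ-natural ε {n} {m} p _ i | last = begin
  (extendᴾ p (fromℕ n) >>= ξᴾ ε m)   ≡⟨ cong (_>>= ξᴾ ε m) (extendᴾ-fromℕ p) ⟩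
  ξᴾ ε m (fromℕ m)                   ≡⟨ ξᴾ-fromℕ-ε m ⟩
  nothing                            ≡⟨ cong (_>>= p) (ξᴾ-fromℕ-ε n) ⟨
  (ξᴾ ε n (fromℕ n) >>= p)           ∎
  where open ≡-Reasoning
ξᴾ-natural δ {n} {m} p preserves i | last = begin
  (extendᴾ p (fromℕ n) >>= ξᴾ δ m)   ≡⟨ cong (_>>= ξᴾ δ m) (extendᴾ-fromℕ p) ⟩
  ξᴾ δ m (fromℕ m)                   ≡⟨ ξᴾ-fromℕ-δ m ⟩
  lastOf m                           ≡⟨ preserves ⟨
  (lastOf n >>= p)                   ≡⟨ cong (_>>= p) (ξᴾ-fromℕ-δ n) ⟨
  (ξᴾ δ n (fromℕ n) >>= p)           ∎
  where open ≡-Reasoning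

P-δ-preservesLast : ∀ {n m} (f : Term n m) → PreservesLast (P δ f)
P-δ-preservesLast (𝟏 n)       = >>=-identityʳ (lastOf n)
P-δ-preservesLast (ξ n)       = ξᴾ-fromℕ-δ n
P-δ-preservesLast {n} (g ∘ f) = begin
  (lastOf n >>= λ x → P δ f x >>= P δ g)   ≡⟨ >>=-assoc (lastOf n) (P δ f) (P δ g) ⟨
  ((lastOf n >>= P δ f) >>= P δ g)         ≡⟨ cong (_>>= P δ g) (P-δ-preservesLast f) ⟩
  (lastOf _ >>= P δ g)                     ≡⟨ P-δ-preservesLast g ⟩
  lastOf _                                 ∎
  where open ≡-Reasoning
P-δ-preservesLast (M f)       = extendᴾ-fromℕ (P δ f)

P-ξ-compatible : ∀ α {n m} (f : Term n m) → ξ-Compatible α (P α f)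
P-ξ-compatible ε f = tt
P-ξ-compatible δ f = P-δ-preservesLast f

P-resp-≈ : ∀ α {n m} {f g : Term n m} → f ≈ g → P α f ≗ᴾ P α g
P-resp-≈ α ≈-refl              i = refl
P-resp-≈ α (≈-sym e)           i = sym (P-resp-≈ α e i)
P-resp-≈ α (≈-trans e e′)      i = trans (P-resp-≈ α e i) (P-resp-≈ α e′ i)
P-resp-≈ α (∘-cong {g′ = g′} {f = f} eg ef) i =
  trans (>>=-congʳ (P α f i) (P-resp-≈ α eg)) (cong (_>>= P α g′) (P-resp-≈ α ef i))
P-resp-≈ α (M-cong e)          = extendᴾ-cong (P-resp-≈ α e)
P-resp-≈ α (idʳ f)             i = refl
P-resp-≈ α (idˡ f)             i = >>=-identityʳ (P α f i)
P-resp-≈ α (assoc h g f)       i = >>=-assoc (P α f i) (P α g) (P α h)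
P-resp-≈ α (M𝟏 n)              = extendᴾ-just
P-resp-≈ α (M∘ g f)            = extendᴾ->>= (P α f) (P α g)
P-resp-≈ α (ξ-nat f)           = ξᴾ-natural α (P α f) (P-ξ-compatible α f)

_≟just_ : ∀ {m} → Maybe (Fin m) → Fin m → Bool
nothing ≟just j = false
just a  ≟just j = toℕ a ≡ᵇ toℕ j

graph : ∀ {n m} → PF n m → Relation n m
graph p i j = p i ≟just j

≟just-injective : ∀ {m} (x y : Maybe (Fin m)) → (∀ j → (x ≟just j) ≡ (y ≟just j)) → x ≡ y
≟just-injective nothing  nothing  x≗y = refl
≟just-injective (just a) nothing  x≗y = contradiction (trans (sym (≡ᵇ-refl (toℕ a))) (x≗y a)) λ ()
≟just-injective nothing  (just b) x≗y = contradiction (trans (x≗y b) (≡ᵇ-refl (toℕ b))) λ ()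
≟just-injective (just a) (just b) x≗y =
  cong just (toℕ-injective (≡ᵇ-true⇒≡ (toℕ a) (toℕ b) (trans (x≗y b) (≡ᵇ-refl (toℕ b)))))

graph-injective : ∀ {n m} (p q : PF n m) → graph p ≐ graph q → p ≗ᴾ q
graph-injective p q p≐q i = ≟just-injective (p i) (q i) (p≐q i)

anyFin-false : ∀ m → anyFin {m} (λ _ → false) ≡ false
anyFin-false zero    = refl
anyFin-false (suc m) = anyFin-false m

anyFin-cong : ∀ {m} {p q : Fin m → Bool} → (∀ j → p j ≡ q j) → anyFin p ≡ anyFin q
anyFin-cong {zero}  p≗q = refl
anyFin-cong {suc m} p≗q = cong₂ _∨_ (p≗q zero) (anyFin-cong (λ j → p≗q (suc j)))

anyFin-≡ᵇ-∧ : ∀ {m} (a : Fin m) (p : Fin m → Bool) → anyFin (λ j → (toℕ a ≡ᵇ toℕ j) ∧ p j) ≡ p a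
anyFin-≡ᵇ-∧ {suc m} zero    p = trans (cong (p zero ∨_) (anyFin-false m)) (∨-identityʳ (p zero))
anyFin-≡ᵇ-∧ {suc m} (suc a) p = anyFin-≡ᵇ-∧ a (λ j → p (suc j))

graph-⊚ : ∀ {n m k} (p : PF n m) (q : PF m k) → (graph q ⊚ graph p) ≐ graph (λ i → p i >>= q)
graph-⊚ {m = m} p q i l with p i
... | nothing = anyFin-false m
... | just a  = anyFin-≡ᵇ-∧ a (λ j → q j ≟just l)

graph-extend : ∀ {n m} (R : Relation n m) (p : PF n m) → R ≐ graph p → extend R ≐ graph (extendᴾ p)
graph-extend {n} {m} R p R≐p i j with inject₁-or-last n i | inject₁-or-last m j
... | inject i | inject j rewrite initial?-inject₁ n i | initial?-inject₁ m j =
  trans (R≐p i j) (map-inject₁-≟just (p i))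
  where
  map-inject₁-≟just : ∀ z → (z ≟just j) ≡ (Maybe.map inject₁ z ≟just inject₁ j)
  map-inject₁-≟just nothing  = refl
  map-inject₁-≟just (just a) rewrite toℕ-inject₁ a | toℕ-inject₁ j = refl
... | inject i | last rewrite initial?-inject₁ n i | initial?-fromℕ m = map-inject₁-≢fromℕ (p i)
  where
  map-inject₁-≢fromℕ : ∀ z → false ≡ (Maybe.map inject₁ z ≟just fromℕ m)
  map-inject₁-≢fromℕ nothing  = refl
  map-inject₁-≢fromℕ (just a) = sym (toℕ-≡ᵇ-≢ {i = inject₁ a} (λ eq → fromℕ≢inject₁ (sym eq)))
... | last | inject j rewrite initial?-fromℕ n | initial?-inject₁ m j = sym (toℕ-≡ᵇ-≢ (fromℕ≢inject₁ {i = j}))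
... | last | last     rewrite initial?-fromℕ n | initial?-fromℕ m = sym (≡ᵇ-refl (toℕ (fromℕ m)))

graph-ξᴾ : ∀ α n → Gξ α n ≐ graph (ξᴾ α n)
graph-ξᴾ α zero i ()
graph-ξᴾ ε (suc n) i j with inject₁-or-last (suc n) i
... | inject i rewrite ξᴾ-inject₁ ε (suc n) i | toℕ-inject₁ i = refl
... | last     rewrite ξᴾ-fromℕ-ε (suc n) | toℕ-fromℕ (suc n) = ≢⇒≡ᵇ-false (>⇒≢ (toℕ<n j))
graph-ξᴾ δ (suc n) i j with inject₁-or-last (suc n) i
... | inject i rewrite ξᴾ-inject₁ δ (suc n) i | toℕ-inject₁ i
                     | ≢⇒≡ᵇ-false (<⇒≢ (toℕ<n i)) = ∨-identityʳ _
... | last     rewrite ξᴾ-fromℕ-δ (suc n) | toℕ-fromℕ (suc n) | toℕ-fromℕ n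
                     | ≢⇒≡ᵇ-false (>⇒≢ (toℕ<n j)) | ≡ᵇ-refl n = ≡ᵇ-sym (toℕ j) n

G≐graph-P : ∀ α {n m} (f : Term n m) → G α f ≐ graph (P α f)
G≐graph-P α (𝟏 n)   i j = refl
G≐graph-P α (ξ n)       = graph-ξᴾ α n
G≐graph-P α (g ∘ f) i k =
  trans (anyFin-cong (λ j → cong₂ _∧_ (G≐graph-P α f i j) (G≐graph-P α g j k)))
        (graph-⊚ (P α f) (P α g) i k)
G≐graph-P α (M f)       = graph-extend (G α f) (P α f) (G≐graph-P α f)

data NF : ℕ → ℕ → Set where
  nil  : NF zero zero
  keep : ∀ {n m} → NF n m → NF (suc n) (suc m)
  drop : ∀ {n m} → NF n m → NF (suc n) m

⌜_⌝ : ∀ {n m} → NF n m → Term n m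
⌜ nil ⌝          = 𝟏 zero
⌜ keep a ⌝       = M ⌜ a ⌝
⌜ drop {n} a ⌝   = ⌜ a ⌝ ∘ ξ n

idᴺ : ∀ n → NF n n
idᴺ zero    = nil
idᴺ (suc n) = keep (idᴺ n)

infixr 9 _∘ᴺ_

_∘ᴺ_ : ∀ {n m k} → NF m k → NF n m → NF n k
b      ∘ᴺ nil    = b
b      ∘ᴺ drop a = drop (b ∘ᴺ a)
keep b ∘ᴺ keep a = keep (b ∘ᴺ a)
drop b ∘ᴺ keep a = drop (b ∘ᴺ a)

nf : ∀ {n m} → Term n m → NF n m
nf (𝟏 n)   = idᴺ n
nf (ξ n)   = drop (idᴺ n)
nf (g ∘ f) = nf g ∘ᴺ nf f
nf (M f)   = keep (nf f)

≡⇒≈ : ∀ {n m} {f g : Term n m} → f ≡ g → f ≈ g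
≡⇒≈ refl = ≈-refl

𝟏≈⌜idᴺ⌝ : ∀ n → 𝟏 n ≈ ⌜ idᴺ n ⌝
𝟏≈⌜idᴺ⌝ zero    = ≈-refl
𝟏≈⌜idᴺ⌝ (suc n) = ≈-trans (≈-sym (M𝟏 n)) (M-cong (𝟏≈⌜idᴺ⌝ n))

⌜∘ᴺ⌝ : ∀ {n m k} (b : NF m k) (a : NF n m) → ⌜ b ⌝ ∘ ⌜ a ⌝ ≈ ⌜ b ∘ᴺ a ⌝
⌜∘ᴺ⌝ b        nil            = idʳ ⌜ b ⌝
⌜∘ᴺ⌝ b        (drop {n} a)   =
  ≈-trans (assoc ⌜ b ⌝ ⌜ a ⌝ (ξ n)) (∘-cong (⌜∘ᴺ⌝ b a) ≈-refl)
⌜∘ᴺ⌝ (keep b) (keep a)       = ≈-trans (≈-sym (M∘ ⌜ b ⌝ ⌜ a ⌝)) (M-cong (⌜∘ᴺ⌝ b a))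
⌜∘ᴺ⌝ (drop {m} b) (keep {n} a) =
  ≈-trans (≈-sym (assoc ⌜ b ⌝ (ξ m) (M ⌜ a ⌝)))
  (≈-trans (∘-cong ≈-refl (ξ-nat ⌜ a ⌝))
  (≈-trans (assoc ⌜ b ⌝ ⌜ a ⌝ (ξ n)) (∘-cong (⌜∘ᴺ⌝ b a) ≈-refl)))

≈⌜nf⌝ : ∀ {n m} (f : Term n m) → f ≈ ⌜ nf f ⌝
≈⌜nf⌝ (𝟏 n)   = 𝟏≈⌜idᴺ⌝ n
≈⌜nf⌝ (ξ n)   = ≈-trans (≈-sym (idˡ (ξ n))) (∘-cong (𝟏≈⌜idᴺ⌝ n) ≈-refl)
≈⌜nf⌝ (g ∘ f) = ≈-trans (∘-cong (≈⌜nf⌝ g) (≈⌜nf⌝ f)) (⌜∘ᴺ⌝ (nf g) (nf f))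
≈⌜nf⌝ (M f)   = M-cong (≈⌜nf⌝ f)

map-inject₁≢just-fromℕ : ∀ {m} (z : Maybe (Fin m)) → Maybe.map inject₁ z ≢ just (fromℕ m)
map-inject₁≢just-fromℕ nothing  ()
map-inject₁≢just-fromℕ (just a) eq = fromℕ≢inject₁ (sym (just-injective eq))

keep≢drop : ∀ α {n m} (a : NF n m) (b : NF n (suc m)) → ¬ (P α ⌜ keep a ⌝ ≗ᴾ P α ⌜ drop b ⌝)
keep≢drop ε {n} {m} a b same = contradiction (begin
  just (fromℕ m)               ≡⟨ extendᴾ-fromℕ (P ε ⌜ a ⌝) ⟨
  P ε ⌜ keep a ⌝ (fromℕ n)     ≡⟨ same (fromℕ n) ⟩
  P ε ⌜ drop b ⌝ (fromℕ n)     ≡⟨ cong (_>>= P ε ⌜ b ⌝) (ξᴾ-fromℕ-ε n) ⟩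
  nothing                      ∎) λ ()
  where open ≡-Reasoning
keep≢drop δ {zero}  a ()
keep≢drop δ {suc n} a b same = map-inject₁≢just-fromℕ (P δ ⌜ a ⌝ (fromℕ n)) (begin
  Maybe.map inject₁ (P δ ⌜ a ⌝ (fromℕ n))      ≡⟨ extendᴾ-inject₁ (P δ ⌜ a ⌝) (fromℕ n) ⟨
  P δ ⌜ keep a ⌝ (inject₁ (fromℕ n))           ≡⟨ same (inject₁ (fromℕ n)) ⟩
  P δ ⌜ drop b ⌝ (inject₁ (fromℕ n))           ≡⟨ cong (_>>= P δ ⌜ b ⌝) (ξᴾ-inject₁ δ (suc n) (fromℕ n)) ⟩
  P δ ⌜ b ⌝ (fromℕ n)                          ≡⟨ P-δ-preservesLast ⌜ b ⌝ ⟩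
  just (fromℕ _)                               ∎)
  where open ≡-Reasoning

P-⌜⌝-injective : ∀ α {n m} (a b : NF n m) → P α ⌜ a ⌝ ≗ᴾ P α ⌜ b ⌝ → a ≡ b
P-⌜⌝-injective α nil      nil      same = refl
P-⌜⌝-injective α (keep a) (keep b) same = cong keep (P-⌜⌝-injective α a b (λ i →
  map-injective inject₁-injective
    (trans (sym (extendᴾ-inject₁ (P α ⌜ a ⌝) i))
           (trans (same (inject₁ i)) (extendᴾ-inject₁ (P α ⌜ b ⌝) i)))))
P-⌜⌝-injective α (drop {n} a) (drop b) same = cong drop (P-⌜⌝-injective α a b (λ i →
  trans (sym (cong (_>>= P α ⌜ a ⌝) (ξᴾ-inject₁ α n i)))
  (trans (same (inject₁ i)) (cong (_>>= P α ⌜ b ⌝) (ξᴾ-inject₁ α n i)))))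
P-⌜⌝-injective α (keep a) (drop b) same = contradiction same (keep≢drop α a b)
P-⌜⌝-injective α (drop a) (keep b) same = contradiction (λ i → sym (same i)) (keep≢drop α b a)

faithful : ∀ α → Faithful α
faithful α f g Gf≐Gg = ≈-trans (≈⌜nf⌝ f) (≈-trans (≡⇒≈ (cong ⌜_⌝ nf-f≡nf-g)) (≈-sym (≈⌜nf⌝ g)))
  where
  Pf≗Pg : P α f ≗ᴾ P α g
  Pf≗Pg = graph-injective (P α f) (P α g) (λ i j →
    trans (sym (G≐graph-P α f i j)) (trans (Gf≐Gg i j) (G≐graph-P α g i j)))

  nf-f≡nf-g : nf f ≡ nf g
  nf-f≡nf-g = P-⌜⌝-injective α (nf f) (nf g) (λ i →
    trans (sym (P-resp-≈ α (≈⌜nf⌝ f) i)) (trans (Pf≗Pg i) (P-resp-≈ α (≈⌜nf⌝ g) i)))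

mainTheorem1 : Faithful ε × Faithful δ
mainTheorem1 = faithful ε , faithful δ
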